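{- Consider any execution of pdqsort (as described in the context), a distinct value $v$, and the first call, in execution order, in which an element comparing equal to $v$ is selected as pivot; denote this pivot element by $v$ and let $r$ be the position where it is placed by the partition step. Then, until another element comparing equal to $v$ is selected as a pivot, every element $x$ comparing equal to $v$ (other than the pivot $v$ itself) lies in the partition directly to the right of $v$, i.e. in a subarray beginning at position $r+1$ whose predecessor is $v$.
   Context: Setting. The input is an array $A[0..n-1]$ of elements compared by a strict weak ordering $<$; $a,b$ compare equal if neither $a<b$ nor $b<a$ (an equivalence relation whose classes are called distinct values); $a\le b$ means "not $b<a$". pdqsort is the following recursive procedure acting in place on contiguous subarrays $A[a..b)=(A[a],\dots,A[b-1])$, each call carrying an integer counter $t$; the top-level call is on $A[0..n)$ with $t=\lfloor\log_2 n\rfloor$. A subarray $A[a..b)$ is leftmost if $a=0$; otherwise its predecessor is the element currently at position $a-1$. Fixed constants are an insertion-sort threshold $c\ge3$, a parameter $p\in(0,1)$, and a constant move bound. A call on $A[a..b)$ with $m=b-a$ does: (1) if $m\le c$, insertion sort $A[a..b)$ and return; (2) if $t=0$, heapsort $A[a..b)$ and return; (3) select a pivot $q$ as the median of at least three sampled elements of $A[a..b)$ by a deterministic rule, and move it to position $a$; (4) if $a>0$ and the predecessor compares equal to $q$, apply partition_left: rearrange $A[a..b)$ so that $q$ ends at a position $r$, all elements of $A[a..r)$ are $\le q$ and all elements of $A[r+1..b)$ are $>q$; otherwise apply partition_right: rearrange so that $q$ ends at a position $r$, all elements of $A[a..r)$ are $<q$ and all of $A[r+1..b)$ are $\ge q$;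 (5) the partition is bad if $\min(r-a,b-r-1)<pm$; if bad, set $t:=t-1$ and swap $O(1)$ elements at fixed relative positions inside each of the two parts; (6) if partition_right was applied, the partition is not bad, and no element other than the pivot was moved, run on both parts an insertion sort that aborts after the constant number of moves; if both complete, return; (7) if partition_left was applied, recurse only on $A[r+1..b)$; otherwise recurse on $A[a..r)$ and then on $A[r+1..b)$, each with counter $t$. The subarrays passed to recursive calls in step (7) are called partitions (subsequences) of the parent call.
   Formalization: The parameter p of the bad-partition test is a rational number in the interval (0,1). -}

module Defs where

open import Data.Nat using (ℕ; zero; suc; _+_; _*_; _∸_; _≤_; _<_; _⊓_)
open import Data.Nat.Logarithm using (⌊log₂_⌋)
open import Data.Fin using (Fin; toℕ)
open import Data.Fin.Permutation using (Permutation′; _⟨$⟩ʳ_)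
open import Data.List using (List; []; _∷_; _++_)
open import Data.Product using (Σ; ∃; _×_; _,_)
open import Data.Sum using (_⊎_)
open import Relation.Nullary using (¬_)
import Data.Empty
open import Relation.Binary.PropositionalEquality using (_≡_)

Equiv : {X : Set} → (X → X → Set) → X → X → Set
Equiv _<_ a b = ¬ (a < b) × ¬ (b < a)

record IsStrictWeakOrder {X : Set} (_<_ : X → X → Set) : Set where
  field
    irrefl       : ∀ x → ¬ (x < x)
    trans        : ∀ {x y z} → x < y → y < z → x < z
    equiv-trans  : ∀ {x y z} → Equiv _<_ x y → Equiv _<_ y z → Equiv _<_ x z

-- Relational model of all executions of pdqsort.
--
-- Parameters: the order _≺_ (the paper's <) on values, the insertion-sort threshold c,
-- the bad-partition parameter p = pn / pd, the array length n, and the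
-- input array key : Fin n → X (key i is the value of the element that
-- initially sits at position i).  Elements are identified by their
-- initial position (an element of Fin n), so that we can follow an
-- individual element through the execution.  A state of the array is a
-- map  Arr = Fin n → Fin n  sending a position to the element at it.

module PDQ {X : Set} (_≺_ : X → X → Set) (c pn pd n : ℕ) (key : Fin n → X) where

  Arr : Set
  Arr = Fin n → Fin n

  _≃_ : X → X → Set
  x ≃ y = Equiv _≺_ x y

  Rearr : ℕ → ℕ → Arr → Arr → Set
  Rearr a b σ σ' =
    Σ (Permutation′ n) λ ρ →
      (∀ i → (toℕ i < a ⊎ b ≤ toℕ i) → ρ ⟨$⟩ʳ i ≡ i) ×
      (∀ i → σ' i ≡ σ (ρ ⟨$⟩ʳ i))

  SortedOn : ℕ → ℕ → Arr → Set
  SortedOn a b σ = ∀ i j → a ≤ toℕ i → toℕ i < toℕ j → toℕ j < b →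
                   ¬ (key (σ j) ≺ key (σ i))

  At : Arr → ℕ → Fin n → Set
  At σ r e = Σ (Fin n) λ i → toℕ i ≡ r × σ i ≡ e

  Select : ℕ → ℕ → Arr → Fin n → Arr → Set
  Select a b σ q σ₁ =
    (Σ (Fin n) λ j → a ≤ toℕ j × toℕ j < b × σ j ≡ q) ×
    Rearr a b σ σ₁ × At σ₁ a q

  -- step (4) condition: a > 0 and the predecessor A[a-1] compares equal to q
  PredEq : Arr → ℕ → Fin n → Set
  PredEq σ a q = Σ (Fin n) λ i → suc (toℕ i) ≡ a × (key (σ i) ≃ key q)

  PartL : ℕ → ℕ → Fin n → Arr → ℕ → Arr → Set
  PartL a b q σ₁ r σ₂ =
    Rearr a b σ₁ σ₂ × a ≤ r × r < b × At σ₂ r q ×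
    (∀ i → a ≤ toℕ i → toℕ i < r → ¬ (key q ≺ key (σ₂ i))) ×
    (∀ i → r < toℕ i → toℕ i < b → key q ≺ key (σ₂ i))

  PartR : ℕ → ℕ → Fin n → Arr → ℕ → Arr → Set
  PartR a b q σ₁ r σ₂ =
    Rearr a b σ₁ σ₂ × a ≤ r × r < b × At σ₂ r q ×
    (∀ i → a ≤ toℕ i → toℕ i < r → key (σ₂ i) ≺ key q) ×
    (∀ i → r < toℕ i → toℕ i < b → ¬ (key (σ₂ i) ≺ key q))

  -- step (5): the partition is bad iff min(r-a, b-r-1) < p·m, p = pn/pd
  Bad : ℕ → ℕ → ℕ → Set
  Bad a b r = pd * ((r ∸ a) ⊓ (b ∸ suc r)) < pn * (b ∸ a)

  Counter : ℕ → ℕ → ℕ → ℕ → ℕ → Set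
  Counter t a b r t' = (Bad a b r × t' ≡ t ∸ 1) ⊎ (¬ Bad a b r × t' ≡ t)

  data Event : Set where
    enter  : (a b : ℕ) → Arr → Event
    sel    : (q : Fin n) → Event
    placed : (a b : ℕ) (q : Fin n) (r : ℕ) → Event
    snap   : Arr → Event

  -- Call t a b σ tr σ' : a call of pdqsort on A[a..b) with counter t,
  -- started in state σ, can run producing trace tr and ending in state σ'.
  data Call : ℕ → ℕ → ℕ → Arr → List Event → Arr → Set where
    small : ∀ {t a b σ σ'} → b ∸ a ≤ c → Rearr a b σ σ' → SortedOn a b σ' →
            Call t a b σ (enter a b σ ∷ snap σ' ∷ []) σ'
    heap  : ∀ {a b σ σ'} → c < b ∸ a → Rearr a b σ σ' → SortedOn a b σ' →
            Call zero a b σ (enter a b σ ∷ snap σ' ∷ []) σ'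
    -- (3),(4) partition_left, (5), (7) recurse on the right part only
    left  : ∀ {t a b σ q σ₁ r σ₂ t' σ₃ σ₄ tr σ₅} →
            c < b ∸ a → Select a b σ q σ₁ → PredEq σ₁ a q → PartL a b q σ₁ r σ₂ →
            Counter (suc t) a b r t' → Rearr a r σ₂ σ₃ → Rearr (suc r) b σ₃ σ₄ →
            Call t' (suc r) b σ₄ tr σ₅ →
            Call (suc t) a b σ
              (enter a b σ ∷ sel q ∷ snap σ₁ ∷ placed a b q r ∷ snap σ₂ ∷
               snap σ₃ ∷ snap σ₄ ∷ tr) σ₅
    -- (3),(4) partition_right, (5) not bad, (6) both insertion sorts complete
    right-done : ∀ {t a b σ q σ₁ r σ₂ σ₃ σ₄} →
            c < b ∸ a → Select a b σ q σ₁ → ¬ PredEq σ₁ a q → PartR a b q σ₁ r σ₂ →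
            ¬ Bad a b r → Rearr a r σ₂ σ₃ → SortedOn a r σ₃ →
            Rearr (suc r) b σ₃ σ₄ → SortedOn (suc r) b σ₄ →
            Call (suc t) a b σ
              (enter a b σ ∷ sel q ∷ snap σ₁ ∷ placed a b q r ∷ snap σ₂ ∷
               snap σ₃ ∷ snap σ₄ ∷ []) σ₄
    -- (3),(4) partition_right, (5), possibly aborted (6), (7) recurse on both parts
    right : ∀ {t a b σ q σ₁ r σ₂ t' σ₃ σ₄ tr₁ σ₅ tr₂ σ₆} →
            c < b ∸ a → Select a b σ q σ₁ → ¬ PredEq σ₁ a q → PartR a b q σ₁ r σ₂ →
            Counter (suc t) a b r t' → Rearr a r σ₂ σ₃ → Rearr (suc r) b σ₃ σ₄ →
            Call t' a r σ₄ tr₁ σ₅ → Call t' (suc r) b σ₅ tr₂ σ₆ →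
            Call (suc t) a b σ
              (enter a b σ ∷ sel q ∷ snap σ₁ ∷ placed a b q r ∷ snap σ₂ ∷
               snap σ₃ ∷ snap σ₄ ∷ tr₁ ++ tr₂) σ₆

  init : Arr
  init i = i

  Run : List Event → Arr → Set
  Run tr σ' = Call ⌊log₂ n ⌋ 0 n init tr σ'

  SelEq : Fin n → Event → Set
  SelEq v (sel q) = key q ≃ key v
  SelEq v _       = Data.Empty.⊥

module Submission where

-- Before v is selected, every element equal to v stays inside the subarray of the current
-- call: a pivot q not equal to v sends all of them to one side, and the other side, lying
-- entirely below or above v, is handled by calls that never meet them.  When v itself is
-- selected, the predecessor cannot equal it (it lies outside the subarray), so
-- partition_right runs; its left part is below v, so the other equal elements land to the
-- right of v.  From then on v stays at r, and a call on the part right of v has v as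
-- predecessor: either its pivot equals v (the reselection where the claim ends) or it lies
-- above v, and then everything right of that pivot is above v as well.

open import Defs
open import Data.Nat using (ℕ; suc; _≤_; _<_; z≤n; _≤?_; _<?_)
open import Data.Nat.Properties
  using (≤-refl; ≤-trans; <-≤-trans; <⇒≤; n≤1+n; <-cmp; <-irrefl; suc-injective; ≰⇒>; ≮⇒≥)
open import Data.Fin using (Fin; toℕ)
open import Data.Fin.Properties using (toℕ-injective; toℕ<n)
open import Data.Fin.Permutation using (_⟨$⟩ʳ_; _⟨$⟩ˡ_; inverseʳ; inverseˡ; _∘ₚ_) renaming (id to idₚ)
open import Data.List using (List; []; _∷_; _++_)
open import Data.List.Properties using (∷-injective)
open import Data.List.Relation.Unary.All as All using (All; []; _∷_; lookup)
open import Data.List.Relation.Unary.All.Properties using (++⁺; ++⁻ʳ)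
open import Data.List.Membership.Propositional using (_∈_)
open import Data.Product using (Σ; _×_; _,_; proj₁; proj₂)
open import Data.Sum as Sum using (_⊎_; inj₁; inj₂)
open import Data.Empty using (⊥-elim)
open import Relation.Nullary using (¬_; Dec; yes; no)
open import Relation.Nullary.Decidable using (_×-dec_)
open import Relation.Binary.Definitions using (tri<; tri≈; tri>)
open import Relation.Binary.PropositionalEquality using (_≡_; _≢_; refl; sym; trans; cong; subst)

data Split++ {A : Set} (xs ys pre : List A) (z : A) (rest : List A) : Set where
  inˡ : (r₁ : List A) → xs ≡ pre ++ z ∷ r₁ → rest ≡ r₁ ++ ys → Split++ xs ys pre z rest
  inʳ : (p₂ : List A) → pre ≡ xs ++ p₂ → ys ≡ p₂ ++ z ∷ rest → Split++ xs ys pre z rest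

split-++ : {A : Set} (xs : List A) {ys : List A} (pre : List A) {z : A} {rest : List A} →
           xs ++ ys ≡ pre ++ z ∷ rest → Split++ xs ys pre z rest
split-++ []       pre       eq   = inʳ pre refl eq
split-++ (x ∷ xs) []        refl = inˡ xs refl refl
split-++ (x ∷ xs) (p ∷ pre) eq with ∷-injective eq
... | refl , eq′ with split-++ xs pre eq′
...   | inˡ r₁ refl refl = inˡ r₁ refl refl
...   | inʳ p₂ refl refl = inʳ p₂ refl refl

module WeakOrderProperties {X : Set} {_≺_ : X → X → Set} (swo : IsStrictWeakOrder _≺_) where
  open IsStrictWeakOrder swo renaming (trans to ≺-trans)

  private variable
    x y z : X

  asym : x ≺ y → ¬ y ≺ x
  asym x≺y y≺x = irrefl _ (≺-trans x≺y y≺x)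

  Equiv-refl : Equiv _≺_ x x
  Equiv-refl = irrefl _ , irrefl _

  Equiv-sym : Equiv _≺_ x y → Equiv _≺_ y x
  Equiv-sym (x≮y , y≮x) = y≮x , x≮y

  ≮-respˡ-Equiv : Equiv _≺_ x y → ¬ x ≺ z → ¬ y ≺ z
  ≮-respˡ-Equiv x≃y x≮z y≺z =
    proj₁ (equiv-trans (Equiv-sym x≃y) (x≮z , λ z≺x → proj₂ x≃y (≺-trans y≺z z≺x))) y≺z

  ≯-respʳ-Equiv : Equiv _≺_ x y → ¬ z ≺ x → ¬ z ≺ y
  ≯-respʳ-Equiv x≃y z≮x z≺y =
    proj₁ (equiv-trans (z≮x , λ x≺z → proj₁ x≃y (≺-trans x≺z z≺y)) x≃y) z≺y

module Rearrangement {X : Set} (_≺_ : X → X → Set) (c pn pd n : ℕ) (key : Fin n → X) where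
  open PDQ _≺_ c pn pd n key

  private variable
    a b l h l′ h′ L H r t : ℕ
    σ σ′ σ″ σ₀ σ₁ σ₂ σ₃ σ₄ σ₅ σ₆ : Arr
    i q x : Fin n
    e : Event
    tr tr₁ tr₂ pre rest post ys : List Event
    P : Fin n → Set

  InRange : ℕ → ℕ → Fin n → Set
  InRange l h i = l ≤ toℕ i × toℕ i < h

  inRange? : ∀ l h i → Dec (InRange l h i)
  inRange? l h i = (l ≤? toℕ i) ×-dec (toℕ i <? h)

  outside : ∀ i → ¬ InRange l h i → toℕ i < l ⊎ h ≤ toℕ i
  outside {l} i i∉ with l ≤? toℕ i
  ... | yes l≤i = inj₂ (≮⇒≥ λ i<h → i∉ (l≤i , i<h))
  ... | no  l≰i = inj₁ (≰⇒> l≰i)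

  apart : ∀ i → h ≤ L ⊎ H ≤ l → InRange L H i → ¬ InRange l h i
  apart i (inj₁ h≤L) (L≤i , _) (_ , i<h) = <-irrefl refl (<-≤-trans i<h (≤-trans h≤L L≤i))
  apart i (inj₂ H≤l) (_ , i<H) (l≤i , _) = <-irrefl refl (<-≤-trans i<H (≤-trans H≤l l≤i))

  -- Rearr wrapped in a record, so that both states can be inferred from the type
  record _↭[_,_]_ (σ : Arr) (l h : ℕ) (σ′ : Arr) : Set where
    constructor ⟨_⟩
    field rearr : Rearr l h σ σ′

  ↭-refl : σ ↭[ l , h ] σ
  ↭-refl = ⟨ idₚ , (λ _ _ → refl) , (λ _ → refl) ⟩

  ↭-trans : σ₁ ↭[ l , h ] σ₂ → σ₂ ↭[ l , h ] σ₃ → σ₁ ↭[ l , h ] σ₃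
  ↭-trans ⟨ ρ₁ , fix₁ , eq₁ ⟩ ⟨ ρ₂ , fix₂ , eq₂ ⟩ =
    ⟨ ρ₂ ∘ₚ ρ₁ ,
      (λ i i∉ → trans (cong (ρ₁ ⟨$⟩ʳ_) (fix₂ i i∉)) (fix₁ i i∉)) ,
      (λ i → trans (eq₂ i) (eq₁ _)) ⟩

  ↭-⊆ : l ≤ l′ → h′ ≤ h → σ ↭[ l′ , h′ ] σ′ → σ ↭[ l , h ] σ′
  ↭-⊆ {l} {l′} {h′} {h} l≤l′ h′≤h ⟨ ρ , fix , eq ⟩ = ⟨ ρ , fix′ , eq ⟩
    where
    fix′ : ∀ i → toℕ i < l ⊎ h ≤ toℕ i → ρ ⟨$⟩ʳ i ≡ i
    fix′ i (inj₁ i<l) = fix i (inj₁ (<-≤-trans i<l l≤l′))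
    fix′ i (inj₂ h≤i) = fix i (inj₂ (≤-trans h′≤h h≤i))

  ↭-outside : σ ↭[ l , h ] σ′ → ¬ InRange l h i → σ′ i ≡ σ i
  ↭-outside {σ = σ} {i = i} ⟨ ρ , fix , eq ⟩ i∉ = trans (eq i) (cong σ (fix i (outside i i∉)))

  ↭-inside : σ ↭[ l , h ] σ′ → InRange l h i → Σ (Fin n) λ j → InRange l h j × σ′ i ≡ σ j
  ↭-inside {l = l} {h} {i = i} ⟨ ρ , fix , eq ⟩ i∈ = ρ ⟨$⟩ʳ i , stays , eq i
    where
    stays : InRange l h (ρ ⟨$⟩ʳ i)
    stays with inRange? l h (ρ ⟨$⟩ʳ i)
    ... | yes ρi∈ = ρi∈
    ... | no  ρi∉ = ⊥-elim (ρi∉ (subst (InRange l h) (sym ρi≡i) i∈))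
      where
      -- ρ fixes ρ i, so by injectivity it fixes i
      ρi≡i : ρ ⟨$⟩ʳ i ≡ i
      ρi≡i = trans (sym (inverseˡ ρ)) (trans (cong (ρ ⟨$⟩ˡ_) (fix _ (outside _ ρi∉))) (inverseˡ ρ))

  Onto : Arr → Set
  Onto σ = ∀ x → Σ (Fin n) λ i → σ i ≡ x

  Onto-rearr : σ ↭[ l , h ] σ′ → Onto σ → Onto σ′
  Onto-rearr {σ = σ} ⟨ ρ , _ , eq ⟩ onto x with onto x
  ... | j , σj≡x = ρ ⟨$⟩ˡ j , trans (eq _) (trans (cong σ (inverseʳ ρ)) σj≡x)

  At-rearr : σ ↭[ l , h ] σ′ → (at : At σ r x) → ¬ InRange l h (proj₁ at) → At σ′ r x
  At-rearr R (i , i≡r , σi≡x) i∉ = i , i≡r , trans (↭-outside R i∉) σi≡x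

  At-≡ : At σ r x → toℕ i ≡ r → σ i ≡ x
  At-≡ {σ} (j , j≡r , σj≡x) i≡r = trans (cong σ (toℕ-injective (trans i≡r (sym j≡r)))) σj≡x

  AllIn : (Fin n → Set) → ℕ → ℕ → Arr → Set
  AllIn P l h σ = ∀ i → InRange l h i → P (σ i)

  OnlyIn : (Fin n → Set) → ℕ → ℕ → Arr → Set
  OnlyIn P l h σ = ∀ i → P (σ i) → InRange l h i

  AllIn-⊆ : L ≤ l → h ≤ H → AllIn P L H σ → AllIn P l h σ
  AllIn-⊆ L≤l h≤H all i (l≤i , i<h) = all i (≤-trans L≤l l≤i , <-≤-trans i<h h≤H)

  AllIn-rearr : σ ↭[ l , h ] σ′ → AllIn P l h σ → AllIn P l h σ′
  AllIn-rearr {P = P} R all i i∈ with ↭-inside R i∈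
  ... | j , j∈ , σ′i≡σj = subst P (sym σ′i≡σj) (all j j∈)

  AllIn-rearr-apart : σ ↭[ l , h ] σ′ → h ≤ L ⊎ H ≤ l → AllIn P L H σ → AllIn P L H σ′
  AllIn-rearr-apart {P = P} R disjoint all i i∈ =
    subst P (sym (↭-outside R (apart i disjoint i∈))) (all i i∈)

  OnlyIn-rearr-⊆ : σ ↭[ l , h ] σ′ → L ≤ l → h ≤ H → OnlyIn P L H σ → OnlyIn P L H σ′
  OnlyIn-rearr-⊆ {l = l} {h} {P = P} R L≤l h≤H only i p with inRange? l h i
  ... | yes (l≤i , i<h) = ≤-trans L≤l l≤i , <-≤-trans i<h h≤H
  ... | no  i∉          = only i (subst P (↭-outside R i∉) p)

  OnlyIn-rearr : σ ↭[ l , h ] σ′ → OnlyIn P l h σ → OnlyIn P l h σ′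
  OnlyIn-rearr {P = P} R = OnlyIn-rearr-⊆ {P = P} R ≤-refl ≤-refl

  OnlyIn-rearr-free : σ ↭[ l , h ] σ′ → AllIn (λ x → ¬ P x) l h σ → OnlyIn P L H σ → OnlyIn P L H σ′
  OnlyIn-rearr-free {l = l} {h} {P = P} R free only i p with inRange? l h i
  ... | no  i∉ = only i (subst P (↭-outside R i∉) p)
  ... | yes i∈ with ↭-inside R i∈
  ...   | j , j∈ , σ′i≡σj = ⊥-elim (free j j∈ (subst P σ′i≡σj p))

  OnlyIn-narrowˡ : OnlyIn P a b σ → At σ r q → ¬ P q → AllIn (λ x → ¬ P x) (suc r) b σ → OnlyIn P a r σ
  OnlyIn-narrowˡ {P = P} {r = r} only at ¬pq free i p with only i p | <-cmp (toℕ i) r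
  ... | a≤i , _   | tri< i<r _ _ = a≤i , i<r
  ... | _         | tri≈ _ i≡r _ = ⊥-elim (¬pq (subst P (At-≡ at i≡r) p))
  ... | _ , i<b   | tri> _ _ r<i = ⊥-elim (free i (r<i , i<b) p)

  OnlyIn-narrowʳ : OnlyIn P a b σ → At σ r q → ¬ P q → AllIn (λ x → ¬ P x) a r σ → OnlyIn P (suc r) b σ
  OnlyIn-narrowʳ {P = P} {r = r} only at ¬pq free i p with only i p | <-cmp (toℕ i) r
  ... | a≤i , _   | tri< i<r _ _ = ⊥-elim (free i (a≤i , i<r) p)
  ... | _         | tri≈ _ i≡r _ = ⊥-elim (¬pq (subst P (At-≡ at i≡r) p))
  ... | _ , i<b   | tri> _ _ r<i = r<i , i<b

  Occurs : ℕ → ℕ → Arr → Fin n → Set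
  Occurs l h σ x = Σ (Fin n) λ j → l ≤ toℕ j × toℕ j < h × σ j ≡ x

  Occurs-AllIn : AllIn P l h σ → Occurs l h σ x → P x
  Occurs-AllIn {P = P} all (j , l≤j , j<h , σj≡x) = subst P σj≡x (all j (l≤j , j<h))

  Occurs-sub : σ ↭[ l , h ] σ₀ → l ≤ l′ → h′ ≤ h → Occurs l′ h′ σ₀ x → Occurs l h σ x
  Occurs-sub R l≤l′ h′≤h (j , l′≤j , j<h′ , σ₀j≡x)
    with ↭-inside R (≤-trans l≤l′ l′≤j , <-≤-trans j<h′ h′≤h)
  ... | k , (l≤k , k<h) , σ₀j≡σk = k , l≤k , k<h , trans (sym σ₀j≡σk) σ₀j≡x

  Confined : ℕ → ℕ → Arr → Event → Set
  Confined l h σ (enter l′ h′ σ′)  = l ≤ l′ × h′ ≤ h × σ ↭[ l , h ] σ′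
  Confined l h σ (sel q)           = Occurs l h σ q
  Confined l h σ (placed _ _ q _)  = Occurs l h σ q
  Confined l h σ (snap σ′)         = σ ↭[ l , h ] σ′

  Confined-sub : σ ↭[ l , h ] σ₀ → l ≤ l′ → h′ ≤ h → Confined l′ h′ σ₀ e → Confined l h σ e
  Confined-sub {e = enter _ _ _} R l≤l′ h′≤h (l′≤l″ , h″≤h′ , R′) =
    ≤-trans l≤l′ l′≤l″ , ≤-trans h″≤h′ h′≤h , ↭-trans R (↭-⊆ l≤l′ h′≤h R′)
  Confined-sub {e = sel _}          R l≤l′ h′≤h occ = Occurs-sub R l≤l′ h′≤h occ
  Confined-sub {e = placed _ _ _ _} R l≤l′ h′≤h occ = Occurs-sub R l≤l′ h′≤h occ
  Confined-sub {e = snap _}         R l≤l′ h′≤h R′  = ↭-trans R (↭-⊆ l≤l′ h′≤h R′)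

  record Partitioning (a b : ℕ) (σ : Arr) (q : Fin n) (σ₁ : Arr) (r : ℕ) (σ₂ σ₃ σ₄ : Arr) : Set where
    field
      pivot-occurs : Occurs a b σ q
      select       : σ ↭[ a , b ] σ₁
      partition    : σ₁ ↭[ a , b ] σ₂
      a≤r          : a ≤ r
      r<b          : r < b
      pivot-at     : At σ₂ r q
      sortˡ        : σ₂ ↭[ a , r ] σ₃
      sortʳ        : σ₃ ↭[ suc r , b ] σ₄

    events : List Event
    events = enter a b σ ∷ sel q ∷ snap σ₁ ∷ placed a b q r ∷ snap σ₂ ∷ snap σ₃ ∷ snap σ₄ ∷ []

    a≤1+r : a ≤ suc r
    a≤1+r = ≤-trans a≤r (n≤1+n r)

    widenˡ : σ′ ↭[ a , r ] σ″ → σ′ ↭[ a , b ] σ″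
    widenˡ = ↭-⊆ ≤-refl (<⇒≤ r<b)

    widenʳ : σ′ ↭[ suc r , b ] σ″ → σ′ ↭[ a , b ] σ″
    widenʳ = ↭-⊆ a≤1+r ≤-refl

    reach₂ : σ ↭[ a , b ] σ₂
    reach₂ = ↭-trans select partition

    reach₃ : σ ↭[ a , b ] σ₃
    reach₃ = ↭-trans reach₂ (widenˡ sortˡ)

    reach₄ : σ ↭[ a , b ] σ₄
    reach₄ = ↭-trans reach₃ (widenʳ sortʳ)

    confined : All (Confined a b σ) events
    confined = (≤-refl , ≤-refl , ↭-refl) ∷ pivot-occurs ∷ select ∷ pivot-occurs ∷
               reach₂ ∷ reach₃ ∷ reach₄ ∷ []

    then-left : σ₄ ↭[ a , r ] σ′ → σ ↭[ a , b ] σ′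
    then-left R = ↭-trans reach₄ (widenˡ R)

    then-right : σ₄ ↭[ suc r , b ] σ′ → σ ↭[ a , b ] σ′
    then-right R = ↭-trans reach₄ (widenʳ R)

    then-both : σ₄ ↭[ a , r ] σ₅ → σ₅ ↭[ suc r , b ] σ′ → σ ↭[ a , b ] σ′
    then-both R₁ R₂ = ↭-trans (then-left R₁) (widenʳ R₂)

    confined-then-right : All (Confined (suc r) b σ₄) tr → All (Confined a b σ) (events ++ tr)
    confined-then-right cs = ++⁺ confined (All.map (Confined-sub reach₄ a≤1+r ≤-refl) cs)

    confined-then-both : All (Confined a r σ₄) tr₁ → σ₄ ↭[ a , r ] σ₅ → All (Confined (suc r) b σ₅) tr₂ →
                         All (Confined a b σ) (events ++ tr₁ ++ tr₂)
    confined-then-both cs₁ R cs₂ =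
      ++⁺ confined (++⁺ (All.map (Confined-sub reach₄ ≤-refl (<⇒≤ r<b)) cs₁)
                        (All.map (Confined-sub (then-left R) a≤1+r ≤-refl) cs₂))

  open Partitioning public

  partitioning : ∀ {q σ₁ σ₂ σ₃ σ₄} {Rest : Set} → Select a b σ q σ₁ →
                 Rearr a b σ₁ σ₂ × a ≤ r × r < b × At σ₂ r q × Rest →
                 Rearr a r σ₂ σ₃ → Rearr (suc r) b σ₃ σ₄ → Partitioning a b σ q σ₁ r σ₂ σ₃ σ₄
  partitioning (occ , R₁ , _) (R₂ , a≤r , r<b , at , _) R₃ R₄ = record
    { pivot-occurs = occ ; select = ⟨ R₁ ⟩ ; partition = ⟨ R₂ ⟩ ; a≤r = a≤r ; r<b = r<b
    ; pivot-at = at ; sortˡ = ⟨ R₃ ⟩ ; sortʳ = ⟨ R₄ ⟩ }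

  Call-↭ : Call t a b σ tr σ′ → σ ↭[ a , b ] σ′
  Call-↭ (small _ R _)                    = ⟨ R ⟩
  Call-↭ (heap _ R _)                     = ⟨ R ⟩
  Call-↭ (left _ s _ p _ R₃ R₄ C)         = then-right (partitioning s p R₃ R₄) (Call-↭ C)
  Call-↭ (right-done _ s _ p _ R₃ _ R₄ _) = reach₄ (partitioning s p R₃ R₄)
  Call-↭ (right _ s _ p _ R₃ R₄ C₁ C₂)    = then-both (partitioning s p R₃ R₄) (Call-↭ C₁) (Call-↭ C₂)

  Call-confined : Call t a b σ tr σ′ → All (Confined a b σ) tr
  Call-confined (small _ R _) = (≤-refl , ≤-refl , ↭-refl) ∷ ⟨ R ⟩ ∷ []
  Call-confined (heap _ R _)  = (≤-refl , ≤-refl , ↭-refl) ∷ ⟨ R ⟩ ∷ []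
  Call-confined (left _ s _ p _ R₃ R₄ C) =
    confined-then-right (partitioning s p R₃ R₄) (Call-confined C)
  Call-confined (right-done _ s _ p _ R₃ _ R₄ _) = confined (partitioning s p R₃ R₄)
  Call-confined (right _ s _ p _ R₃ R₄ C₁ C₂) =
    confined-then-both (partitioning s p R₃ R₄) (Call-confined C₁) (Call-↭ C₁) (Call-confined C₂)

  module FixedValue (swo : IsStrictWeakOrder _≺_) (v : Fin n) where
    open WeakOrderProperties swo

    private variable
      r₀ b₀ : ℕ

    Eqv : Fin n → Set
    Eqv x = key x ≃ key v

    EqvOther : Fin n → Set
    EqvOther x = Eqv x × x ≢ v

    NotEqv : Fin n → Set
    NotEqv x = ¬ Eqv x

    NotBelow : Fin n → Set
    NotBelow x = ¬ key x ≺ key v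

    NoEqvIn : ℕ → ℕ → Arr → Set
    NoEqvIn = AllIn NotEqv

    NotBelowV : ℕ → ℕ → Arr → Set
    NotBelowV = AllIn NotBelow

    NoSelEq : List Event → Set
    NoSelEq = All (λ e → ¬ SelEq v e)

    Separated : ℕ → ℕ → Arr → Set
    Separated r b σ = Onto σ × At σ r v × OnlyIn EqvOther (suc r) b σ

    AfterV : ℕ → ℕ → Event → Set
    AfterV r b (enter a′ b′ σ)  = ∀ (i : Fin n) → key (σ i) ≃ key v → σ i ≢ v →
                                  a′ ≤ toℕ i → toℕ i < b′ → a′ ≡ suc r × At σ r v
    AfterV r b (sel q)          = ¬ Eqv q
    AfterV r b (placed _ _ q _) = q ≢ v
    AfterV r b (snap σ)         = At σ r v ×
                                  (∀ x → key x ≃ key v → x ≢ v →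
                                     Σ (Fin n) λ i → σ i ≡ x × suc r ≤ toℕ i × toℕ i < b)

    data UntilReselect (r b : ℕ) : List Event → Set where
      []       : UntilReselect r b []
      reselect : SelEq v e → UntilReselect r b (e ∷ tr)
      _∷_      : AfterV r b e → UntilReselect r b tr → UntilReselect r b (e ∷ tr)

    ¬Eqv⇒≢v : ¬ Eqv q → q ≢ v
    ¬Eqv⇒≢v ¬eq refl = ¬eq Equiv-refl

    NoSelEq-∌ : ∀ pre → NoSelEq tr → tr ≢ pre ++ sel v ∷ rest
    NoSelEq-∌ pre ns refl with ++⁻ʳ pre ns
    ... | ¬selv ∷ _ = ¬selv Equiv-refl

    AfterV⇒¬SelEq : AfterV r b e → ¬ SelEq v e
    AfterV⇒¬SelEq {e = sel _} ¬eq = ¬eq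

    All⇒UntilReselect : All (AfterV r b) tr → UntilReselect r b tr
    All⇒UntilReselect []         = []
    All⇒UntilReselect (ok ∷ oks) = ok ∷ All⇒UntilReselect oks

    UntilReselect-++ : UntilReselect r b tr₁ → (NoSelEq tr₁ → UntilReselect r b tr₂) →
                       UntilReselect r b (tr₁ ++ tr₂)
    UntilReselect-++ []              k = k []
    UntilReselect-++ (reselect s)    k = reselect s
    UntilReselect-++ (ok ∷ until)    k = ok ∷ UntilReselect-++ until (λ ns → k (AfterV⇒¬SelEq ok ∷ ns))

    UntilReselect-prefix : ∀ tr₁ → UntilReselect r b (tr₁ ++ tr₂) → NoSelEq tr₁ → All (AfterV r b) tr₁
    UntilReselect-prefix []        _              _          = []
    UntilReselect-prefix (_ ∷ tr₁) (reselect s)   (¬s ∷ _)   = ⊥-elim (¬s s)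
    UntilReselect-prefix (_ ∷ tr₁) (ok ∷ until)   (_ ∷ ns)   = ok ∷ UntilReselect-prefix tr₁ until ns

    UntilReselect-drop : ∀ tr₁ → UntilReselect r b (tr₁ ++ tr₂) → NoSelEq tr₁ → UntilReselect r b tr₂
    UntilReselect-drop []        until          _          = until
    UntilReselect-drop (_ ∷ tr₁) (reselect s)   (¬s ∷ _)   = ⊥-elim (¬s s)
    UntilReselect-drop (_ ∷ tr₁) (_ ∷ until)    (_ ∷ ns)   = UntilReselect-drop tr₁ until ns

    Separated-rearr-free : σ ↭[ l , h ] σ′ → NoEqvIn l h σ → Separated r b σ → Separated r b σ′
    Separated-rearr-free R free (onto , at@(i , _ , σi≡v) , only) =
      Onto-rearr R onto ,
      At-rearr R at (λ i∈ → free i i∈ (subst Eqv (sym σi≡v) Equiv-refl)) ,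
      OnlyIn-rearr-free {P = EqvOther} R (λ j j∈ eq → free j j∈ (proj₁ eq)) only

    Separated-rearr-right : σ ↭[ l , h ] σ′ → suc r ≤ l → h ≤ b → Separated r b σ → Separated r b σ′
    Separated-rearr-right R r<l h≤b (onto , at@(i , i≡r , _) , only) =
      Onto-rearr R onto ,
      At-rearr R at (λ (l≤i , _) → <-irrefl refl (≤-trans r<l (subst (_ ≤_) i≡r l≤i))) ,
      OnlyIn-rearr-⊆ {P = EqvOther} R r<l h≤b only

    Separated⇒AfterV : Separated r b σ → AfterV r b (snap σ)
    Separated⇒AfterV {r} {b} {σ} (onto , at , only) = at , placement
      where
      placement : ∀ x → Eqv x → x ≢ v → Σ (Fin n) λ i → σ i ≡ x × InRange (suc r) b i
      placement x eq x≢v with onto x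
      ... | i , σi≡x = i , σi≡x , only i (subst Eqv (sym σi≡x) eq , subst (_≢ v) (sym σi≡x) x≢v)

    Confined-free⇒AfterV : NoEqvIn l h σ → Separated r b σ → Confined l h σ e → AfterV r b e
    Confined-free⇒AfterV {e = enter _ _ _} free _ (l≤l′ , h′≤h , R) i eq _ l′≤i i<h′ =
      ⊥-elim (AllIn-rearr {P = NotEqv} R free i (≤-trans l≤l′ l′≤i , <-≤-trans i<h′ h′≤h) eq)
    Confined-free⇒AfterV {e = sel _}          free _   occ = Occurs-AllIn free occ
    Confined-free⇒AfterV {e = placed _ _ _ _} free _   occ = ¬Eqv⇒≢v (Occurs-AllIn free occ)
    Confined-free⇒AfterV {e = snap _}         free sep R   =
      Separated⇒AfterV (Separated-rearr-free R free sep)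

    free-call-after-v : Call t l h σ tr σ′ → NoEqvIn l h σ → Separated r b σ →
                        All (AfterV r b) tr × Separated r b σ′
    free-call-after-v C free sep =
      All.map (Confined-free⇒AfterV free sep) (Call-confined C) ,
      Separated-rearr-free (Call-↭ C) free sep

    free-call-NoSelEq : Call t l h σ tr σ′ → NoEqvIn l h σ → NoSelEq tr
    free-call-NoSelEq {l = l} {h} {σ} C free = All.map no-sel (Call-confined C)
      where
      no-sel : Confined l h σ e → ¬ SelEq v e
      no-sel {e = sel _} occ = Occurs-AllIn free occ

    -- the non-strict form that partition_left and partition_right both guarantee
    Partitioned : ℕ → ℕ → Fin n → ℕ → Arr → Set
    Partitioned a b q r σ = (∀ i → a ≤ toℕ i → toℕ i < r → ¬ key q ≺ key (σ i)) ×
                            (∀ i → r < toℕ i → toℕ i < b → ¬ key (σ i) ≺ key q)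

    partitionedˡ : (∀ i → a ≤ toℕ i → toℕ i < r → ¬ key q ≺ key (σ i)) →
                   (∀ i → r < toℕ i → toℕ i < b → key q ≺ key (σ i)) → Partitioned a b q r σ
    partitionedˡ ≤q >q = ≤q , λ i r<i i<b → asym (>q i r<i i<b)

    partitionedʳ : (∀ i → a ≤ toℕ i → toℕ i < r → key (σ i) ≺ key q) →
                   (∀ i → r < toℕ i → toℕ i < b → ¬ key (σ i) ≺ key q) → Partitioned a b q r σ
    partitionedʳ <q ≥q = (λ i a≤i i<r → asym (<q i a≤i i<r)) , ≥q

    right-free : (∀ i → r < toℕ i → toℕ i < b → ¬ key (σ i) ≺ key q) →
                 ¬ Eqv q → ¬ key q ≺ key v → NoEqvIn (suc r) b σ
    right-free ≥q ¬eq q≮v i (r<i , i<b) eq = ¬eq (q≮v , ≮-respˡ-Equiv eq (≥q i r<i i<b))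

    left-free : (∀ i → a ≤ toℕ i → toℕ i < r → ¬ key q ≺ key (σ i)) →
                ¬ Eqv q → ¬ key v ≺ key q → NoEqvIn a r σ
    left-free ≤q ¬eq v≮q i (a≤i , i<r) eq = ¬eq (≯-respʳ-Equiv eq (≤q i a≤i i<r) , v≮q)

    EqvLeftOf : ℕ → ℕ → ℕ → Arr → Set
    EqvLeftOf a r b σ = OnlyIn Eqv a r σ × NoEqvIn (suc r) b σ

    EqvRightOf : ℕ → ℕ → ℕ → Arr → Set
    EqvRightOf a r b σ = OnlyIn Eqv (suc r) b σ × NoEqvIn a r σ

    EqvOneSide : ℕ → ℕ → ℕ → Arr → Set
    EqvOneSide a r b σ = EqvLeftOf a r b σ ⊎ EqvRightOf a r b σ

    EqvLeftOf-sortˡ : σ ↭[ a , r ] σ′ → EqvLeftOf a r b σ → EqvLeftOf a r b σ′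
    EqvLeftOf-sortˡ {r = r} R (only , free) =
      OnlyIn-rearr {P = Eqv} R only , AllIn-rearr-apart {P = NotEqv} R (inj₁ (n≤1+n r)) free

    EqvLeftOf-sortʳ : σ ↭[ suc r , b ] σ′ → EqvLeftOf a r b σ → EqvLeftOf a r b σ′
    EqvLeftOf-sortʳ R (only , free) =
      OnlyIn-rearr-free {P = Eqv} R free only , AllIn-rearr {P = NotEqv} R free

    EqvRightOf-sortˡ : σ ↭[ a , r ] σ′ → EqvRightOf a r b σ → EqvRightOf a r b σ′
    EqvRightOf-sortˡ R (only , free) =
      OnlyIn-rearr-free {P = Eqv} R free only , AllIn-rearr {P = NotEqv} R free

    EqvRightOf-sortʳ : σ ↭[ suc r , b ] σ′ → EqvRightOf a r b σ → EqvRightOf a r b σ′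
    EqvRightOf-sortʳ {r = r} R (only , free) =
      OnlyIn-rearr {P = Eqv} R only , AllIn-rearr-apart {P = NotEqv} R (inj₂ (n≤1+n r)) free

    v-side : Onto σ → OnlyIn Eqv a b σ → At σ r q → Partitioned a b q r σ → ¬ Eqv q → EqvOneSide a r b σ
    v-side {σ} {a} {b} {r} {q} onto only at (≤q , ≥q) ¬eq with onto v
    ... | j , σj≡v with only j (subst Eqv (sym σj≡v) Equiv-refl) | <-cmp (toℕ j) r
    ...   | a≤j , _ | tri< j<r _ _ = inj₁ (OnlyIn-narrowˡ {P = Eqv} only at ¬eq free , free)
      where
      free : NoEqvIn (suc r) b σ
      free = right-free ≥q ¬eq (subst (λ x → ¬ key q ≺ key x) σj≡v (≤q j a≤j j<r))
    ...   | _ | tri≈ _ j≡r _ = ⊥-elim (¬eq (subst Eqv (trans (sym σj≡v) (At-≡ at j≡r)) Equiv-refl))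
    ...   | _ , j<b | tri> _ _ r<j = inj₂ (OnlyIn-narrowʳ {P = Eqv} only at ¬eq free , free)
      where
      free : NoEqvIn a r σ
      free = left-free ≤q ¬eq (subst (λ x → ¬ key x ≺ key q) σj≡v (≥q j r<j j<b))

    side-of-v : (part : Partitioning a b σ q σ₁ r σ₂ σ₃ σ₄) → Partitioned a b q r σ₂ →
                Onto σ → OnlyIn Eqv a b σ → ¬ Eqv q → EqvOneSide a r b σ₄
    side-of-v part split onto only ¬eq =
      Sum.map (EqvLeftOf-sortʳ (sortʳ part)) (EqvRightOf-sortʳ (sortʳ part))
        (Sum.map (EqvLeftOf-sortˡ (sortˡ part)) (EqvRightOf-sortˡ (sortˡ part))
          (v-side (Onto-rearr (reach₂ part) onto) (OnlyIn-rearr {P = Eqv} (reach₂ part) only)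
                  (pivot-at part) split ¬eq))

    VPlaced : ℕ → ℕ → ℕ → Arr → Set
    VPlaced a r b σ = Separated r b σ × NoEqvIn a r σ × NotBelowV (suc r) b σ

    v-placed : Onto σ → OnlyIn Eqv a b σ → At σ r v →
               (∀ i → a ≤ toℕ i → toℕ i < r → key (σ i) ≺ key v) →
               (∀ i → r < toℕ i → toℕ i < b → ¬ key (σ i) ≺ key v) → VPlaced a r b σ
    v-placed {σ} {a} {b} {r} onto only at <v ≥v =
      (onto , at , OnlyIn-narrowʳ {P = EqvOther} (λ i eq → only i (proj₁ eq)) at (λ eq → proj₂ eq refl)
                     (λ i i∈ eq → free i i∈ (proj₁ eq))) ,
      free , λ i (r<i , i<b) → ≥v i r<i i<b
      where
      free : NoEqvIn a r σ
      free i (a≤i , i<r) eq = proj₁ eq (<v i a≤i i<r)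

    VPlaced-sortˡ : σ ↭[ a , r ] σ′ → VPlaced a r b σ → VPlaced a r b σ′
    VPlaced-sortˡ {r = r} R (sep , free , ≥v) =
      Separated-rearr-free R free sep , AllIn-rearr {P = NotEqv} R free ,
      AllIn-rearr-apart {P = NotBelow} R (inj₁ (n≤1+n r)) ≥v

    VPlaced-sortʳ : σ ↭[ suc r , b ] σ′ → VPlaced a r b σ → VPlaced a r b σ′
    VPlaced-sortʳ {r = r} R (sep , free , ≥v) =
      Separated-rearr-right R ≤-refl ≤-refl sep ,
      AllIn-rearr-apart {P = NotEqv} R (inj₂ (n≤1+n r)) free ,
      AllIn-rearr {P = NotBelow} R ≥v

    PredEq-v : At σ r v → PredEq σ (suc r) q → Eqv q
    PredEq-v at (i , 1+i≡1+r , σi≃q) =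
      Equiv-sym (subst (λ x → key x ≃ key _) (At-≡ at (suc-injective 1+i≡1+r)) σi≃q)

    ¬PredEq-v : At σ r v → ¬ PredEq σ (suc r) q → ¬ Eqv q
    ¬PredEq-v (i , i≡r , σi≡v) ¬pe eq =
      ¬pe (i , cong suc i≡r , subst (λ x → key x ≃ key _) (sym σi≡v) (Equiv-sym eq))

    PredEq-outside : OnlyIn Eqv a b σ → ¬ PredEq σ a v
    PredEq-outside only (i , 1+i≡a , σi≃v) =
      <-irrefl refl (subst (_≤ toℕ i) (sym 1+i≡a) (proj₁ (only i σi≃v)))

    events-AfterV : (part : Partitioning a b σ q σ₁ r σ₂ σ₃ σ₄) → AfterV r₀ b₀ (enter a b σ) → ¬ Eqv q →
                    (∀ {σ′} → σ ↭[ a , b ] σ′ → Separated r₀ b₀ σ′) → All (AfterV r₀ b₀) (events part)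
    events-AfterV part entry ¬eq kept =
      entry ∷ ¬eq ∷ Separated⇒AfterV (kept (select part)) ∷ ¬Eqv⇒≢v ¬eq ∷
      Separated⇒AfterV (kept (reach₂ part)) ∷ Separated⇒AfterV (kept (reach₃ part)) ∷
      Separated⇒AfterV (kept (reach₄ part)) ∷ []

    -- the pivot is above v, hence so is everything right of it
    right-of-pivot-free : (part : Partitioning l h σ q σ₁ r σ₂ σ₃ σ₄) →
                          (∀ i → r < toℕ i → toℕ i < h → ¬ key (σ₂ i) ≺ key q) → ¬ Eqv q →
                          NotBelowV l h σ → σ₄ ↭[ l , r ] σ₅ → NoEqvIn (suc r) h σ₅
    right-of-pivot-free {r = r} part ≥q ¬eq ≥v R =
      AllIn-rearr-apart {P = NotEqv} R (inj₁ (n≤1+n r))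
        (AllIn-rearr {P = NotEqv} (sortʳ part)
          (AllIn-rearr-apart {P = NotEqv} (sortˡ part) (inj₁ (n≤1+n r))
            (right-free ≥q ¬eq (Occurs-AllIn {P = NotBelow} ≥v (pivot-occurs part)))))

    events-right-of-v : (part : Partitioning (suc r) h σ q σ₁ r₀ σ₂ σ₃ σ₄) → ¬ PredEq σ₁ (suc r) q →
                        h ≤ b → Separated r b σ → ¬ Eqv q × All (AfterV r b) (events part)
    events-right-of-v {r} {h} {σ} {q} {b = b} part ¬pe h≤b sep@(_ , at , _) =
      ¬eq , events-AfterV part (λ _ _ _ _ _ → refl , at) ¬eq kept
      where
      kept : ∀ {σ′} → σ ↭[ suc r , h ] σ′ → Separated r b σ′
      kept R = Separated-rearr-right R ≤-refl h≤b sep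
      ¬eq : ¬ Eqv q
      ¬eq = ¬PredEq-v (proj₁ (proj₂ (kept (select part)))) ¬pe

    right-of-v : Call t (suc r) h σ tr σ′ → h ≤ b → Separated r b σ → NotBelowV (suc r) h σ →
                 UntilReselect r b tr

    right-of-v-partitioned : (part : Partitioning (suc r) h σ q σ₁ r₀ σ₂ σ₃ σ₄) →
                             (∀ i → r₀ < toℕ i → toℕ i < h → ¬ key (σ₂ i) ≺ key q) →
                             ¬ PredEq σ₁ (suc r) q →
                             Call t (suc r) r₀ σ₄ tr₁ σ₅ → Call t (suc r₀) h σ₅ tr₂ σ₆ →
                             h ≤ b → Separated r b σ → NotBelowV (suc r) h σ →
                             UntilReselect r b (events part ++ tr₁ ++ tr₂)

    right-of-v (small _ R _) h≤b sep@(_ , at , _) _ =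
      (λ _ _ _ _ _ → refl , at) ∷ Separated⇒AfterV (Separated-rearr-right ⟨ R ⟩ ≤-refl h≤b sep) ∷ []
    right-of-v (heap _ R _) h≤b sep@(_ , at , _) _ =
      (λ _ _ _ _ _ → refl , at) ∷ Separated⇒AfterV (Separated-rearr-right ⟨ R ⟩ ≤-refl h≤b sep) ∷ []
    right-of-v (left _ (_ , R₁ , _) pe _ _ _ _ _) h≤b sep@(_ , at , _) _ =
      (λ _ _ _ _ _ → refl , at) ∷
      reselect (PredEq-v (proj₁ (proj₂ (Separated-rearr-right ⟨ R₁ ⟩ ≤-refl h≤b sep))) pe)
    right-of-v (right-done _ s ¬pe p _ R₃ _ R₄ _) h≤b sep _ =
      All⇒UntilReselect (proj₂ (events-right-of-v (partitioning s p R₃ R₄) ¬pe h≤b sep))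
    right-of-v (right _ s ¬pe p@(_ , _ , _ , _ , _ , ≥q) _ R₃ R₄ C₁ C₂) =
      right-of-v-partitioned (partitioning s p R₃ R₄) ≥q ¬pe C₁ C₂

    right-of-v-partitioned part ≥q ¬pe C₁ C₂ h≤b sep ≥v with events-right-of-v part ¬pe h≤b sep
    ... | ¬eq , events-ok =
      UntilReselect-++ (All⇒UntilReselect events-ok) λ _ →
      UntilReselect-++ (right-of-v C₁ (≤-trans (<⇒≤ (r<b part)) h≤b)
                          (Separated-rearr-right (reach₄ part) ≤-refl h≤b sep)
                          (AllIn-⊆ {P = NotBelow} ≤-refl (<⇒≤ (r<b part))
                            (AllIn-rearr {P = NotBelow} (reach₄ part) ≥v))) λ _ →
      All⇒UntilReselect (proj₁ (free-call-after-v C₂ (right-of-pivot-free part ≥q ¬eq ≥v (Call-↭ C₁))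
                                  (Separated-rearr-right (then-left part (Call-↭ C₁)) ≤-refl h≤b sep)))

    record AfterSelection (rest : List Event) (σ′ : Arr) : Set where
      constructor after-selection
      field
        state     : Arr
        lo hi pos : ℕ
        events′   : List Event
        shape     : rest ≡ snap state ∷ placed lo hi v pos ∷ events′
        until     : UntilReselect pos hi events′
        final     : Separated pos hi σ′

    AfterSelection-++ : AfterSelection rest σ′ →
                        (∀ {r b} → Separated r b σ′ → All (AfterV r b) ys × Separated r b σ″) →
                        AfterSelection (rest ++ ys) σ″
    AfterSelection-++ (after-selection σ₁ a b r post refl until final) tail =
      after-selection σ₁ a b r _ refl
        (UntilReselect-++ until λ _ → All⇒UntilReselect (proj₁ (tail final))) (proj₂ (tail final))

    sel-in-events : (part : Partitioning a b σ q σ₁ r σ₂ σ₃ σ₄) →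
                    ∀ pre → events part ≡ pre ++ sel v ∷ rest →
                    q ≡ v × rest ≡ snap σ₁ ∷ placed a b q r ∷ snap σ₂ ∷ snap σ₃ ∷ snap σ₄ ∷ []
    sel-in-events _ (_ ∷ []) refl = refl , refl
    sel-in-events _ [] ()
    sel-in-events _ (_ ∷ _ ∷ []) ()
    sel-in-events _ (_ ∷ _ ∷ _ ∷ []) ()
    sel-in-events _ (_ ∷ _ ∷ _ ∷ _ ∷ []) ()
    sel-in-events _ (_ ∷ _ ∷ _ ∷ _ ∷ _ ∷ []) ()
    sel-in-events _ (_ ∷ _ ∷ _ ∷ _ ∷ _ ∷ _ ∷ []) ()
    sel-in-events _ (_ ∷ _ ∷ _ ∷ _ ∷ _ ∷ _ ∷ _ ∷ []) ()
    sel-in-events _ (_ ∷ _ ∷ _ ∷ _ ∷ _ ∷ _ ∷ _ ∷ _ ∷ _) ()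

    events-NoSelEq : (part : Partitioning a b σ q σ₁ r σ₂ σ₃ σ₄) →
                     NoSelEq (events part ++ tr) → ¬ Eqv q × NoSelEq tr
    events-NoSelEq _ (_ ∷ ¬selq ∷ _ ∷ _ ∷ _ ∷ _ ∷ _ ∷ ns) = ¬selq , ns

    selected-here : (part : Partitioning a b σ v σ₁ r σ₂ σ₃ σ₄) →
                    (∀ i → a ≤ toℕ i → toℕ i < r → key (σ₂ i) ≺ key v) →
                    (∀ i → r < toℕ i → toℕ i < b → ¬ key (σ₂ i) ≺ key v) →
                    Onto σ → OnlyIn Eqv a b σ →
                    (VPlaced a r b σ₄ → UntilReselect r b tr × Separated r b σ′) →
                    AfterSelection (snap σ₁ ∷ placed a b v r ∷ snap σ₂ ∷ snap σ₃ ∷ snap σ₄ ∷ tr) σ′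
    selected-here {a} {b} {σ} {σ₁} {r} {σ₂} {σ₃} {σ₄} part <v ≥v onto only rest =
      after-selection _ _ _ _ _ refl
        (Separated⇒AfterV (proj₁ p₂) ∷ Separated⇒AfterV (proj₁ p₃) ∷ Separated⇒AfterV (proj₁ p₄) ∷
         proj₁ (rest p₄))
        (proj₂ (rest p₄))
      where
      p₂ : VPlaced a r b σ₂
      p₂ = v-placed (Onto-rearr (reach₂ part) onto) (OnlyIn-rearr {P = Eqv} (reach₂ part) only)
                    (pivot-at part) <v ≥v
      p₃ : VPlaced a r b σ₃
      p₃ = VPlaced-sortˡ (sortˡ part) p₂
      p₄ : VPlaced a r b σ₄
      p₄ = VPlaced-sortʳ (sortʳ part) p₃

    recurse-after-v : VPlaced a r b σ → Call t a r σ tr₁ σ′ → Call t (suc r) b σ′ tr₂ σ″ →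
                      UntilReselect r b (tr₁ ++ tr₂) × Separated r b σ″
    recurse-after-v {a} {r} {b} {σ} {tr₁ = tr₁} {σ′} (sep , freeˡ , ≥v) C₁ C₂ =
      UntilReselect-++ (All⇒UntilReselect (proj₁ after₁))
                       (λ _ → right-of-v C₂ ≤-refl (proj₂ after₁) ≥v′) ,
      Separated-rearr-right (Call-↭ C₂) ≤-refl ≤-refl (proj₂ after₁)
      where
      after₁ : All (AfterV r b) tr₁ × Separated r b σ′
      after₁ = free-call-after-v C₁ freeˡ sep
      ≥v′ : NotBelowV (suc r) b σ′
      ≥v′ = AllIn-rearr-apart {P = NotBelow} (Call-↭ C₁) (inj₁ (n≤1+n r)) ≥v

    first-selection : Call t a b σ tr σ′ → Onto σ → OnlyIn Eqv a b σ →
                      ∀ pre → tr ≡ pre ++ sel v ∷ rest → NoSelEq pre → AfterSelection rest σ′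

    selection-left : (part : Partitioning a b σ q σ₁ r σ₂ σ₃ σ₄) → Partitioned a b q r σ₂ →
                     PredEq σ₁ a q →
                     Call t (suc r) b σ₄ tr σ′ → Onto σ → OnlyIn Eqv a b σ →
                     ∀ pre → events part ++ tr ≡ pre ++ sel v ∷ rest → NoSelEq pre →
                     AfterSelection rest σ′

    selection-right : (part : Partitioning a b σ q σ₁ r σ₂ σ₃ σ₄) →
                      (∀ i → a ≤ toℕ i → toℕ i < r → key (σ₂ i) ≺ key q) →
                      (∀ i → r < toℕ i → toℕ i < b → ¬ key (σ₂ i) ≺ key q) →
                      Call t a r σ₄ tr₁ σ₅ → Call t (suc r) b σ₅ tr₂ σ₆ → Onto σ → OnlyIn Eqv a b σ →
                      ∀ pre → events part ++ tr₁ ++ tr₂ ≡ pre ++ sel v ∷ rest → NoSelEq pre →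
                      AfterSelection rest σ₆

    first-selection (small _ _ _) _ _ pre eq _ = ⊥-elim (NoSelEq-∌ pre ((λ ()) ∷ (λ ()) ∷ []) eq)
    first-selection (heap _ _ _)  _ _ pre eq _ = ⊥-elim (NoSelEq-∌ pre ((λ ()) ∷ (λ ()) ∷ []) eq)
    first-selection (left _ s pe p@(_ , _ , _ , _ , ≤q , >q) _ R₃ R₄ C) =
      selection-left (partitioning s p R₃ R₄) (partitionedˡ ≤q >q) pe C
    first-selection (right-done _ s _ p@(_ , _ , _ , _ , <q , ≥q) _ R₃ _ R₄ _) onto only pre eq _
      with sel-in-events (partitioning s p R₃ R₄) pre eq
    ... | refl , refl = selected-here (partitioning s p R₃ R₄) <q ≥q onto only λ p₄ → [] , proj₁ p₄
    first-selection (right _ s _ p@(_ , _ , _ , _ , <q , ≥q) _ R₃ R₄ C₁ C₂) =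
      selection-right (partitioning s p R₃ R₄) <q ≥q C₁ C₂

    selection-left part split pe C onto only pre eq ns with split-++ (events part) pre eq
    ... | inˡ r₁ in-events refl with sel-in-events part pre in-events
    ...   | refl , _ = ⊥-elim (PredEq-outside (OnlyIn-rearr {P = Eqv} (select part) only) pe)
    selection-left part split pe C onto only _ _ ns | inʳ pre′ refl tr≡ with events-NoSelEq part ns
    ... | ¬eq , ns′ with side-of-v part split onto only ¬eq
    ...   | inj₁ (_ , freeʳ) = ⊥-elim (NoSelEq-∌ pre′ (free-call-NoSelEq C freeʳ) tr≡)
    ...   | inj₂ (onlyʳ , _) = first-selection C (Onto-rearr (reach₄ part) onto) onlyʳ pre′ tr≡ ns′

    selection-right part <q ≥q C₁ C₂ onto only pre eq ns with split-++ (events part) pre eq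
    ... | inˡ r₁ in-events refl with sel-in-events part pre in-events
    ...   | refl , refl = selected-here part <q ≥q onto only λ p₄ → recurse-after-v p₄ C₁ C₂
    selection-right {tr₁ = tr₁} part <q ≥q C₁ C₂ onto only _ _ ns | inʳ pre′ refl tr≡
      with events-NoSelEq part ns
    ... | ¬eq , ns′ with side-of-v part (partitionedʳ <q ≥q) onto only ¬eq | split-++ tr₁ pre′ tr≡
    ...   | inj₁ vl | inˡ r₁ tr₁≡ refl =
            AfterSelection-++
              (first-selection C₁ (Onto-rearr (reach₄ part) onto) (proj₁ vl) pre′ tr₁≡ ns′)
                              (free-call-after-v C₂ (proj₂ (EqvLeftOf-sortˡ (Call-↭ C₁) vl)))
    ...   | inj₁ vl | inʳ p₂ _ tr₂≡ =
            ⊥-elim (NoSelEq-∌ p₂ (free-call-NoSelEq C₂ (proj₂ (EqvLeftOf-sortˡ (Call-↭ C₁) vl))) tr₂≡)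
    ...   | inj₂ vr | inˡ r₁ tr₁≡ _ = ⊥-elim (NoSelEq-∌ pre′ (free-call-NoSelEq C₁ (proj₂ vr)) tr₁≡)
    ...   | inj₂ vr | inʳ p₂ refl tr₂≡ =
            first-selection C₂ (Onto-rearr (Call-↭ C₁) (Onto-rearr (reach₄ part) onto))
                            (proj₁ (EqvRightOf-sortˡ (Call-↭ C₁) vr)) p₂ tr₂≡ (++⁻ʳ _ ns′)

    until-after-placement : ∀ mid → AfterSelection (mid ++ placed a b v r ∷ post) σ′ → NoSelEq mid →
                            UntilReselect r b post
    until-after-placement []          (after-selection _ _ _ _ _ () _ _) _
    until-after-placement (_ ∷ [])    (after-selection _ _ _ _ _ refl until _) _ = until
    until-after-placement (_ ∷ _ ∷ mid) (after-selection _ _ _ _ _ refl until _) (_ ∷ _ ∷ ns)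
      with UntilReselect-drop mid until ns
    ... | reselect ()
    ... | v≢v ∷ _ = ⊥-elim (v≢v refl)

lemma3 : {X : Set} (_≺_ : X → X → Set) → IsStrictWeakOrder _≺_ →
         (c pn pd : ℕ) → 3 ≤ c → 0 < pn → pn < pd →
         (n : ℕ) (key : Fin n → X) →
         let open PDQ _≺_ c pn pd n key in
         (tr : List Event) (σfin : Arr) → Run tr σfin →
         (v : Fin n) (a b r : ℕ) (pre mid post during after : List Event) →
         tr ≡ pre ++ sel v ∷ mid ++ placed a b v r ∷ post →
         All (λ e → ¬ SelEq v e) pre →
         All (λ e → ¬ SelEq v e) mid →
         post ≡ during ++ after →
         All (λ e → ¬ SelEq v e) during →
         (∀ σ → snap σ ∈ during →
            At σ r v ×
            (∀ x → key x ≃ key v → x ≢ v →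
               Σ (Fin n) λ i → σ i ≡ x × suc r ≤ toℕ i × toℕ i < b)) ×
         (∀ a' b' σ → enter a' b' σ ∈ during →
            ∀ (i : Fin n) → key (σ i) ≃ key v → σ i ≢ v →
            a' ≤ toℕ i → toℕ i < b' →
            a' ≡ suc r × At σ r v)
lemma3 _≺_ swo c pn pd _ _ _ n key tr _ run v a b r pre mid post during _
       tr≡ ns-pre ns-mid post≡ ns-during =
  (λ _ → lookup after-v) , (λ _ _ _ → lookup after-v)
  where
  open Rearrangement _≺_ c pn pd n key
  open FixedValue swo v

  until : UntilReselect r b post
  until = until-after-placement mid
            (first-selection run (λ x → x , refl) (λ i _ → z≤n , toℕ<n i) pre tr≡ ns-pre) ns-mid

  after-v : All (AfterV r b) during
  after-v = UntilReselect-prefix during (subst (UntilReselect r b) post≡ until) ns-during
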